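{- Let $M$ and $N$ be matroids and let $P$ be a tensor product of $M$ and $N$. Let $S,T$ be disjoint subsets of $E(M)$ and $M'=M\setminus S/T$. Then $P'=P\setminus(S\times E(N))/(T\times E(N))$ is a tensor product of $M'$ and $N$.
   Context: Let $M,N$ be matroids. A matroid $P$ on $E(M)\times E(N)$ is a quasi product of $M$ and $N$ if: for every non-loop $e\in E(M)$, $x\mapsto(e,x)$ is an isomorphism $N\cong P|_{\{e\}\times E(N)}$; for every non-loop $f\in E(N)$, $x\mapsto(x,f)$ is an isomorphism $M\cong P|_{E(M)\times\{f\}}$; for every loop $e$ of $M$, $P|_{\{e\}\times E(N)}$ has rank $0$; and for every loop $f$ of $N$, $P|_{E(M)\times\{f\}}$ has rank $0$. A tensor product of $M$ and $N$ is a quasi product with $\mathrm{rk}(P)=\mathrm{rk}(M)\mathrm{rk}(N)$. -}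

module Defs where

open import Data.Nat using (ℕ; zero; suc; _+_; _*_; _∸_; _≤_)
open import Data.Bool using (Bool; true; false; _∧_; _∨_; not; if_then_else_)
open import Data.Fin using (Fin; _≟_)
open import Data.List using (List; []; _∷_; allFin; cartesianProduct)
open import Data.Product using (_×_; _,_; proj₁; proj₂)
open import Relation.Nullary using (¬_)
open import Relation.Nullary.Decidable using (⌊_⌋)
open import Relation.Binary.PropositionalEquality using (_≡_)

SubsetOf : Set → Set
SubsetOf A = A → Bool

module _ {A : Set} where
  _∩_ : SubsetOf A → SubsetOf A → SubsetOf A
  (X ∩ Y) a = X a ∧ Y a

  _∪_ : SubsetOf A → SubsetOf A → SubsetOf A
  (X ∪ Y) a = X a ∨ Y a

  _∖_ : SubsetOf A → SubsetOf A → SubsetOf A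
  (X ∖ Y) a = X a ∧ not (Y a)

  _⊆_ : SubsetOf A → SubsetOf A → Set
  X ⊆ Y = ∀ a → X a ≡ true → Y a ≡ true

  Disjoint : SubsetOf A → SubsetOf A → Set
  Disjoint X Y = ∀ a → X a ≡ true → Y a ≡ false

  card : List A → SubsetOf A → ℕ
  card [] X = 0
  card (a ∷ as) X = if X a then suc (card as X) else card as X

-- Ground set E (a subset of the carrier) together with a rank function.
-- The rank of an arbitrary X is read as the rank of X ∩ E.
record RankFn (A : Set) : Set where
  field
    ground : SubsetOf A
    rk     : SubsetOf A → ℕ
open RankFn public

record IsMatroid {A : Set} (enum : List A) (M : RankFn A) : Set where
  field
    rk-cong  : ∀ X Y → (∀ a → ground M a ≡ true → X a ≡ Y a) → rk M X ≡ rk M Y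
    rk-bound : ∀ X → rk M X ≤ card enum (X ∩ ground M)
    rk-mono  : ∀ X Y → (X ∩ ground M) ⊆ Y → rk M X ≤ rk M Y
    rk-submod : ∀ X Y → rk M (X ∪ Y) + rk M (X ∩ Y) ≤ rk M X + rk M Y

rank : {A : Set} → RankFn A → ℕ
rank M = rk M (λ _ → true)

_∖∖_//_ : {A : Set} → RankFn A → SubsetOf A → SubsetOf A → RankFn A
ground (M ∖∖ S // T) = (ground M ∖ S) ∖ T
rk (M ∖∖ S // T) X = rk M ((X ∩ ((ground M ∖ S) ∖ T)) ∪ T) ∸ rk M T

module _ {k : ℕ} where
  singleton : Fin k → SubsetOf (Fin k)
  singleton e x = ⌊ x ≟ e ⌋

  IsLoop : RankFn (Fin k) → Fin k → Set
  IsLoop M e = (ground M e ≡ true) × (rk M (singleton e) ≡ 0)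

  IsNonLoop : RankFn (Fin k) → Fin k → Set
  IsNonLoop M e = (ground M e ≡ true) × ¬ (rk M (singleton e) ≡ 0)

_×ˢ_ : {A B : Set} → SubsetOf A → SubsetOf B → SubsetOf (A × B)
(X ×ˢ Y) p = X (proj₁ p) ∧ Y (proj₂ p)

module _ {m n : ℕ} where
  record IsQuasiProduct (M : RankFn (Fin m)) (N : RankFn (Fin n))
                        (P : RankFn (Fin m × Fin n)) : Set where
    field
      ground-prod : ∀ p → ground P p ≡ (ground M ×ˢ ground N) p
      -- x ↦ (e , x) is an isomorphism N ≅ P|({e} × E(N))
      row-iso : ∀ e → IsNonLoop M e →
                ∀ X → X ⊆ ground N → rk N X ≡ rk P (singleton e ×ˢ X)
      -- x ↦ (x , f) is an isomorphism M ≅ P|(E(M) × {f})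
      col-iso : ∀ f → IsNonLoop N f →
                ∀ X → X ⊆ ground M → rk M X ≡ rk P (X ×ˢ singleton f)
      row-loop : ∀ e → IsLoop M e → rk P (singleton e ×ˢ ground N) ≡ 0
      col-loop : ∀ f → IsLoop N f → rk P (ground M ×ˢ singleton f) ≡ 0

  record IsTensorProduct (M : RankFn (Fin m)) (N : RankFn (Fin n))
                         (P : RankFn (Fin m × Fin n)) : Set where
    field
      M-matroid : IsMatroid (allFin m) M
      N-matroid : IsMatroid (allFin n) N
      P-matroid : IsMatroid (cartesianProduct (allFin m) (allFin n)) P
      quasi     : IsQuasiProduct M N P
      rank-eq   : rank P ≡ rank M * rank N

-- The heart of the argument is the cylinder formula rk_P(Y × E(N)) = r(N) · r_M(Y) for Y ⊆ E(M).
-- Adding a row {a} × E(N) to a set containing Y × E(N) raises rk_P by at most r(N), and not at all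
-- when a is spanned by Y, since then every point (a , y) is spanned inside the column of y, a copy
-- of M.  Telescoping over the elements of Y bounds the cylinder rank above by r(N) · r_M(Y);
-- telescoping from Y up to E(M), where rk_P = r(M) · r(N), bounds it below.
-- In P′ the rank of Z is rk_P(Z ∪ T × E(N)) − r(N) · r_M(T).  The rank, the rows and the loops of
-- P′ then follow from the cylinder formula and submodularity.  For the column of a non-loop f one
-- shows rk_P(X × {f} ∪ T × E(N)) = r_M(X ∪ T) + (r(N) − 1) · r_M(T) by the same telescoping, where
-- now each rank-raising row costs only r(N) − 1 because its point in column f is already present.

module Submission where

open import Defs
open import Data.Bool using (Bool; true; false; _∧_; _∨_; not)
open import Data.Bool.Properties
  using (∧-identityʳ; ∧-zeroʳ; ∨-identityʳ; ∨-zeroʳ; ∨-assoc; ∨-comm; ∧-distribʳ-∨; ∧-conicalˡ; ∧-conicalʳ)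
  renaming (_≟_ to _≟ᵇ_)
open import Data.Fin using (Fin; _≟_)
open import Data.List using (List; []; _∷_; allFin)
open import Data.List.Membership.Propositional using (_∈_)
open import Data.List.Relation.Unary.Any using (here; there)
open import Data.List.Membership.Propositional.Properties using (∈-allFin)
open import Data.Nat using (ℕ; suc; _+_; _*_; _∸_; _≤_; z≤n) renaming (_≟_ to _≟ℕ_)
open import Data.Nat.Properties hiding (_≟_)
open import Data.Nat.Solver using (module +-*-Solver)
open import Data.Product using (_×_; _,_)
open import Function using (_∘_)
open import Relation.Nullary using (Dec; yes; no; contradiction)
open import Relation.Nullary.Decidable using (True; toWitness; _→-dec_)
open import Relation.Binary.PropositionalEquality
  using (_≡_; _≢_; refl; sym; trans; cong; cong₂; subst; subst₂; module ≡-Reasoning)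

open +-*-Solver using (solve; _:=_; _:+_)

private
  ∀-Bool? : {P : Bool → Set} → Dec (P true) → Dec (P false) → Dec (∀ b → P b)
  ∀-Bool? (yes t) (yes f) = yes λ { true → t ; false → f }
  ∀-Bool? (no ¬t) _       = no λ h → ¬t (h true)
  ∀-Bool? (yes _) (no ¬f) = no λ h → ¬f (h false)

  -- Premises are restricted to equations and implications: an instance for an arbitrary A → B
  -- would overlap with the one for ∀ b → P b.
  instance
    ≡-Bool? : {a b : Bool} → Dec (a ≡ b)
    ≡-Bool? = _ ≟ᵇ _

    ≡⇒-Bool? : {a b : Bool} {B : Set} → {{Dec B}} → Dec (a ≡ b → B)
    ≡⇒-Bool? {{b?}} = (_ ≟ᵇ _) →-dec b?

    ⇒⇒-Bool? : {A A′ B : Set} → {{Dec (A → A′)}} → {{Dec B}} → Dec ((A → A′) → B)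
    ⇒⇒-Bool? {{a?}} {{b?}} = a? →-dec b?

    ∀-Bool?ⁱ : {P : Bool → Set} → {{Dec (P true)}} → {{Dec (P false)}} → Dec (∀ b → P b)
    ∀-Bool?ⁱ {{t?}} {{f?}} = ∀-Bool? t? f?

byTruthTable : {A : Set} {{A? : Dec A}} {_ : True A?} → A
byTruthTable {{A?}} {A-holds} = toWitness A-holds

module _ {A : Set} where
  ∅ : SubsetOf A
  ∅ _ = false

  infix 4 _≐_
  _≐_ : SubsetOf A → SubsetOf A → Set
  X ≐ Y = ∀ a → X a ≡ Y a

  Respects≐ : (SubsetOf A → ℕ) → Set
  Respects≐ F = ∀ {X Y} → X ≐ Y → F X ≡ F Y

  ∩-congʳ : ∀ {X Y} Z → (∀ a → Z a ≡ true → X a ≡ Y a) → X ∩ Z ≐ Y ∩ Z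
  ∩-congʳ {X} {Y} Z h a with Z a in za
  ... | true  = trans (∧-identityʳ (X a)) (trans (h a za) (sym (∧-identityʳ (Y a))))
  ... | false = trans (∧-zeroʳ (X a)) (sym (∧-zeroʳ (Y a)))

  card-resp-≐ : ∀ (as : List A) → Respects≐ (card as)
  card-resp-≐ []       X≐Y = refl
  card-resp-≐ (a ∷ as) {X} {Y} X≐Y rewrite X≐Y a with Y a
  ... | true  = cong suc (card-resp-≐ as X≐Y)
  ... | false = card-resp-≐ as X≐Y

  card-∅ : ∀ (as : List A) → card as ∅ ≡ 0
  card-∅ []       = refl
  card-∅ (_ ∷ as) = card-∅ as

module _ {A B : Set} where
  ×ˢ-⊆ : ∀ {X X′ : SubsetOf A} {Y Y′ : SubsetOf B} → X ⊆ X′ → Y ⊆ Y′ → (X ×ˢ Y) ⊆ (X′ ×ˢ Y′)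
  ×ˢ-⊆ X⊆X′ Y⊆Y′ (a , b) h = cong₂ _∧_ (X⊆X′ a (∧-conicalˡ _ _ h)) (Y⊆Y′ b (∧-conicalʳ _ _ h))

  ×ˢ-⊆ˡ : ∀ {X X′ : SubsetOf A} (Y : SubsetOf B) → X ⊆ X′ → (X ×ˢ Y) ⊆ (X′ ×ˢ Y)
  ×ˢ-⊆ˡ Y X⊆X′ = ×ˢ-⊆ X⊆X′ (λ _ h → h)

  ×ˢ-⊆ʳ : ∀ (X : SubsetOf A) {Y Y′ : SubsetOf B} → Y ⊆ Y′ → (X ×ˢ Y) ⊆ (X ×ˢ Y′)
  ×ˢ-⊆ʳ X Y⊆Y′ = ×ˢ-⊆ (λ _ h → h) Y⊆Y′

  ×ˢ-distribʳ-∪ : ∀ (X X′ : SubsetOf A) (Y : SubsetOf B) → (X ∪ X′) ×ˢ Y ≐ (X ×ˢ Y) ∪ (X′ ×ˢ Y)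
  ×ˢ-distribʳ-∪ X X′ Y (a , b) = ∧-distribʳ-∨ (Y b) (X a) (X′ a)

module _ {k : ℕ} where
  singleton⇒≡ : ∀ {e x : Fin k} → singleton e x ≡ true → x ≡ e
  singleton⇒≡ {e} {x} h with x ≟ e
  ... | yes x≡e = x≡e
  singleton⇒≡ () | no _

  singleton-⊆ : ∀ {Z : SubsetOf (Fin k)} {e} → Z e ≡ true → singleton e ⊆ Z
  singleton-⊆ {Z} Ze x h = subst (λ y → Z y ≡ true) (sym (singleton⇒≡ h)) Ze

  singleton-∈ : ∀ {Z : SubsetOf (Fin k)} {e x} → singleton e x ≡ true → Z x ≡ true → Z e ≡ true
  singleton-∈ {Z} h Zx = subst (λ y → Z y ≡ true) (singleton⇒≡ h) Zx

  singleton-refl : (e : Fin k) → singleton e e ≡ true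
  singleton-refl e with e ≟ e
  ... | yes _   = refl
  ... | no e≢e = contradiction refl e≢e

  elementsOf : List (Fin k) → SubsetOf (Fin k)
  elementsOf []       = ∅
  elementsOf (x ∷ xs) = singleton x ∪ elementsOf xs

  ∈⇒elementsOf : ∀ {y xs} → y ∈ xs → elementsOf xs y ≡ true
  ∈⇒elementsOf {y} {_ ∷ xs} (here refl) = cong (_∨ elementsOf xs y) (singleton-refl y)
  ∈⇒elementsOf {y} (there {x} y∈xs) = trans (cong (singleton x y ∨_) (∈⇒elementsOf y∈xs)) (∨-zeroʳ _)

  subset-induction : (Φ : SubsetOf (Fin k) → Set) → (∀ {X Y} → X ≐ Y → Φ X → Φ Y) → Φ ∅ →
                     (W : SubsetOf (Fin k)) →
                     (∀ X a → W a ≡ true → Φ X → Φ (X ∪ singleton a)) → Φ W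
  subset-induction Φ Φ-resp Φ∅ W Φ-step =
    Φ-resp (λ y → trans (cong (W y ∧_) (∈⇒elementsOf (∈-allFin y))) (∧-identityʳ (W y)))
           (Φ-upto (allFin k))
    where
    Φ-upto : ∀ xs → Φ (W ∩ elementsOf xs)
    Φ-upto []       = Φ-resp (λ y → sym (∧-zeroʳ (W y))) Φ∅
    Φ-upto (x ∷ xs) with W x in Wx
    ... | true  = Φ-resp (λ y → add (W y) _ _ (λ h → singleton-⊆ Wx y h)) (Φ-step _ x Wx (Φ-upto xs))
      where
      add : ∀ w s m → (s ≡ true → w ≡ true) → (w ∧ m) ∨ s ≡ w ∧ (s ∨ m)
      add = byTruthTable
    ... | false = Φ-resp (λ y → skip (W y) _ _ (λ h → trans (cong W (singleton⇒≡ h)) Wx)) (Φ-upto xs)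
      where
      skip : ∀ w s m → (s ≡ true → w ≡ false) → w ∧ m ≡ w ∧ (s ∨ m)
      skip = byTruthTable

∨-trueˡ : ∀ {x y} → x ≡ true → x ∨ y ≡ true
∨-trueˡ {true} _ = refl

∨-trueʳ : ∀ {x y} → y ≡ true → x ∨ y ≡ true
∨-trueʳ {x} refl = ∨-zeroʳ x

module _ {k : ℕ} where
  telescope : (F G : SubsetOf (Fin k) → ℕ) → Respects≐ F → Respects≐ G → (W : SubsetOf (Fin k)) →
              (∀ Y a → W a ≡ true → F (Y ∪ singleton a) + G Y ≤ F Y + G (Y ∪ singleton a)) →
              ∀ Y₀ → F (Y₀ ∪ W) + G Y₀ ≤ F Y₀ + G (Y₀ ∪ W)
  telescope F G F-resp G-resp W step Y₀ = subset-induction Φ Φ-resp Φ∅ W Φ-step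
    where
    Φ : SubsetOf (Fin k) → Set
    Φ X = F (Y₀ ∪ X) + G Y₀ ≤ F Y₀ + G (Y₀ ∪ X)

    Φ-resp : ∀ {X X′} → X ≐ X′ → Φ X → Φ X′
    Φ-resp X≐X′ = subst₂ (λ u v → u + G Y₀ ≤ F Y₀ + v) (F-resp Y₀∪X≐Y₀∪X′) (G-resp Y₀∪X≐Y₀∪X′)
      where Y₀∪X≐Y₀∪X′ = λ a → cong (Y₀ a ∨_) (X≐X′ a)

    Φ∅ : Φ ∅
    Φ∅ = ≤-reflexive (trans (cong (_+ G Y₀) (F-resp Y₀∪∅≐Y₀)) (cong (F Y₀ +_) (sym (G-resp Y₀∪∅≐Y₀))))
      where Y₀∪∅≐Y₀ = λ a → ∨-identityʳ (Y₀ a)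

    chain : ∀ {X₀ X₁ X₂} → F X₁ + G X₀ ≤ F X₀ + G X₁ → F X₂ + G X₁ ≤ F X₁ + G X₂ →
            F X₂ + G X₀ ≤ F X₀ + G X₂
    chain {X₀} {X₁} {X₂} h₁ h₂ = +-cancelʳ-≤ (F X₁ + G X₁) _ _
      (subst₂ _≤_ (solve 4 (λ a b c d → (a :+ b) :+ (c :+ d) := (a :+ d) :+ (c :+ b)) refl
                           (F X₂) (G X₁) (F X₁) (G X₀))
                  (solve 4 (λ a b c d → (a :+ b) :+ (c :+ d) := (c :+ b) :+ (a :+ d)) refl
                           (F X₁) (G X₂) (F X₀) (G X₁))
                  (+-mono-≤ h₂ h₁))

    Φ-step : ∀ X a → W a ≡ true → Φ X → Φ (X ∪ singleton a)
    Φ-step X a Wa ΦX = chain ΦX (subst₂ (λ u v → u + G (Y₀ ∪ X) ≤ F (Y₀ ∪ X) + v)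
                                        (F-resp assoc) (G-resp assoc) (step (Y₀ ∪ X) a Wa))
      where
      assoc : (Y₀ ∪ X) ∪ singleton a ≐ Y₀ ∪ (X ∪ singleton a)
      assoc b = ∨-assoc (Y₀ b) (X b) (singleton a b)

-- f₁ − f₀ ≤ d (g₁ − g₀) without subtraction.
increment-bound : ∀ {f₀ f₁ g₀ g₁} d → g₀ ≤ g₁ → (g₁ ≡ g₀ → f₁ ≤ f₀) → (g₁ ≢ g₀ → f₁ ≤ f₀ + d) →
                  f₁ + d * g₀ ≤ f₀ + d * g₁
increment-bound {f₀} {f₁} {g₀} {g₁} d g₀≤g₁ same grows with g₁ ≟ℕ g₀
... | yes refl = +-monoˡ-≤ (d * g₀) (same refl)
... | no g₁≢g₀ = begin
  f₁ + d * g₀        ≤⟨ +-monoˡ-≤ (d * g₀) (grows g₁≢g₀) ⟩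
  f₀ + d + d * g₀    ≡⟨ +-assoc f₀ d (d * g₀) ⟩
  f₀ + (d + d * g₀)  ≡⟨ cong (f₀ +_) (sym (*-suc d g₀)) ⟩
  f₀ + d * suc g₀    ≤⟨ +-monoʳ-≤ f₀ (*-monoʳ-≤ d (≤∧≢⇒< g₀≤g₁ (g₁≢g₀ ∘ sym))) ⟩
  f₀ + d * g₁        ∎
  where open ≤-Reasoning

module RankLemmas {A : Set} {enum : List A} {M : RankFn A} (isM : IsMatroid enum M) where
  open IsMatroid isM

  rk-resp-≐ : Respects≐ (rk M)
  rk-resp-≐ {X} {Y} X≐Y = rk-cong X Y (λ a _ → X≐Y a)

  rk-mono′ : ∀ {X Y} → (∀ a → X a ≡ true → ground M a ≡ true → Y a ≡ true) → rk M X ≤ rk M Y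
  rk-mono′ {X} {Y} h = rk-mono X Y (λ a XEa → h a (∧-conicalˡ _ _ XEa) (∧-conicalʳ _ _ XEa))

  rk-∩-ground : ∀ X → rk M (X ∩ ground M) ≡ rk M X
  rk-∩-ground X = rk-cong (X ∩ ground M) X (λ a Ea → trans (cong (X a ∧_) Ea) (∧-identityʳ (X a)))

  rk-∅ : rk M ∅ ≡ 0
  rk-∅ = n≤0⇒n≡0 (subst (rk M ∅ ≤_) (card-∅ enum) (rk-bound ∅))

  rk-subadditive : ∀ X Y → rk M (X ∪ Y) ≤ rk M X + rk M Y
  rk-subadditive X Y = m+n≤o⇒m≤o _ (rk-submod X Y)

  rk-∪-null : ∀ Y {Z} → rk M Z ≡ 0 → rk M (Y ∪ Z) ≡ rk M Y
  rk-∪-null Y {Z} rkZ≡0 = ≤-antisym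
    (subst (rk M (Y ∪ Z) ≤_) (trans (cong (rk M Y +_) rkZ≡0) (+-identityʳ _)) (rk-subadditive Y Z))
    (rk-mono′ (λ _ Ya _ → ∨-trueˡ Ya))

  rk-∪-≤ˡ : ∀ X Y → rk M Y ≤ rk M (X ∩ Y) → rk M (X ∪ Y) ≤ rk M X
  rk-∪-≤ˡ X Y h = +-cancelʳ-≤ (rk M (X ∩ Y)) _ _ (≤-trans (rk-submod X Y) (+-monoʳ-≤ (rk M X) h))

∸-submodular : ∀ {u i a b} t → t ≤ u → t ≤ i → t ≤ a → t ≤ b → u + i ≤ a + b →
               (u ∸ t) + (i ∸ t) ≤ (a ∸ t) + (b ∸ t)
∸-submodular {u} {i} {a} {b} t t≤u t≤i t≤a t≤b h =
  +-cancelʳ-≤ (t + t) _ _ (subst₂ _≤_ (sym (shift u i t≤u t≤i)) (sym (shift a b t≤a t≤b)) h)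
  where
  shift : ∀ p q → t ≤ p → t ≤ q → (p ∸ t) + (q ∸ t) + (t + t) ≡ p + q
  shift p q t≤p t≤q =
    trans (solve 3 (λ x y z → (x :+ y) :+ (z :+ z) := (x :+ z) :+ (y :+ z)) refl (p ∸ t) (q ∸ t) t)
          (cong₂ _+_ (m∸n+n≡m t≤p) (m∸n+n≡m t≤q))

module _ {A : Set} {enum : List A} {M : RankFn A} (isM : IsMatroid enum M) (S T : SubsetOf A) where
  open IsMatroid isM
  open RankLemmas isM

  private
    E′ : SubsetOf A
    E′ = ground (M ∖∖ S // T)

    rk-T≤ : ∀ Z → rk M T ≤ rk M ((Z ∩ E′) ∪ T)
    rk-T≤ Z = rk-mono′ (λ _ Ta _ → ∨-trueʳ Ta)

  minor-isMatroid : IsMatroid enum (M ∖∖ S // T)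
  minor-isMatroid = record { rk-cong = cong′ ; rk-bound = bound ; rk-mono = mono ; rk-submod = submod }
    where
    M′ : RankFn A
    M′ = M ∖∖ S // T

    cong′ : ∀ X Y → (∀ a → E′ a ≡ true → X a ≡ Y a) → rk M′ X ≡ rk M′ Y
    cong′ X Y h = cong (_∸ rk M T) (rk-resp-≐ (λ a → cong (_∨ T a) (∩-congʳ E′ h a)))

    ∩-E′-E : ∀ x e s t → (x ∧ ((e ∧ not s) ∧ not t)) ∧ e ≡ x ∧ ((e ∧ not s) ∧ not t)
    ∩-E′-E = byTruthTable

    bound : ∀ X → rk M′ X ≤ card enum (X ∩ E′)
    bound X = begin
      rk M ((X ∩ E′) ∪ T) ∸ rk M T     ≤⟨ m≤n+o⇒m∸n≤o _ (rk M T) (≤-trans (rk-subadditive (X ∩ E′) T)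
                                                                        (≤-reflexive (+-comm _ (rk M T)))) ⟩
      rk M (X ∩ E′)                    ≤⟨ rk-bound (X ∩ E′) ⟩
      card enum ((X ∩ E′) ∩ ground M)  ≡⟨ card-resp-≐ enum (λ a → ∩-E′-E (X a) (ground M a) (S a) (T a)) ⟩
      card enum (X ∩ E′)               ∎
      where open ≤-Reasoning

    ∪T-mono : ∀ x y g t → (x ∧ g ≡ true → y ≡ true) → (x ∧ g) ∨ t ≡ true → (y ∧ g) ∨ t ≡ true
    ∪T-mono = byTruthTable

    mono : ∀ X Y → (X ∩ E′) ⊆ Y → rk M′ X ≤ rk M′ Y
    mono X Y h = ∸-monoˡ-≤ (rk M T) (rk-mono′ (λ a h′ _ → ∪T-mono (X a) (Y a) (E′ a) (T a) (h a) h′))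

    ∪T-∪ : ∀ x y g t → ((x ∧ g) ∨ t) ∨ ((y ∧ g) ∨ t) ≡ ((x ∨ y) ∧ g) ∨ t
    ∪T-∪ = byTruthTable

    ∪T-∩ : ∀ x y g t → ((x ∧ g) ∨ t) ∧ ((y ∧ g) ∨ t) ≡ ((x ∧ y) ∧ g) ∨ t
    ∪T-∩ = byTruthTable

    submod : ∀ X Y → rk M′ (X ∪ Y) + rk M′ (X ∩ Y) ≤ rk M′ X + rk M′ Y
    submod X Y = ∸-submodular (rk M T) (rk-T≤ (X ∪ Y)) (rk-T≤ (X ∩ Y)) (rk-T≤ X) (rk-T≤ Y)
      (subst₂ _≤_ (cong₂ _+_ (rk-resp-≐ (λ a → ∪T-∪ (X a) (Y a) (E′ a) (T a)))
                             (rk-resp-≐ (λ a → ∪T-∩ (X a) (Y a) (E′ a) (T a))))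
                  refl
                  (rk-submod ((X ∩ E′) ∪ T) ((Y ∩ E′) ∪ T)))

  rk-minor : ∀ {Z} → Z ⊆ E′ → rk (M ∖∖ S // T) Z ≡ rk M (Z ∪ T) ∸ rk M T
  rk-minor {Z} Z⊆E′ = cong (_∸ rk M T) (rk-resp-≐ (λ a → absorb (Z a) (E′ a) (T a) (Z⊆E′ a)))
    where
    absorb : ∀ z g t → (z ≡ true → g ≡ true) → (z ∧ g) ∨ t ≡ z ∨ t
    absorb = byTruthTable

  rank-minor : T ⊆ ground M → Disjoint S T → rank (M ∖∖ S // T) ≡ rk M (ground M ∖ S) ∸ rk M T
  rank-minor T⊆E S∩T≡∅ =
    cong (_∸ rk M T) (rk-resp-≐ (λ a → refill (ground M a) (S a) (T a) (T⊆E a) (S∩T≡∅ a)))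
    where
    refill : ∀ e s t → (t ≡ true → e ≡ true) → (s ≡ true → t ≡ false) → ((e ∧ not s) ∧ not t) ∨ t ≡ e ∧ not s
    refill = byTruthTable

module TensorProduct {m n : ℕ} {M : RankFn (Fin m)} {N : RankFn (Fin n)} {P : RankFn (Fin m × Fin n)}
                     (ten : IsTensorProduct M N P) where
  open IsTensorProduct ten
  open IsQuasiProduct quasi
  private
    module M = RankLemmas M-matroid
    module N = RankLemmas N-matroid
    module P = RankLemmas P-matroid

  ρ : ℕ
  ρ = rk N (ground N)

  rank-N≡ρ : rank N ≡ ρ
  rank-N≡ρ = IsMatroid.rk-cong N-matroid _ _ (λ _ Nb → sym Nb)

  rkP-mono : ∀ {X Y} → (∀ a b → X (a , b) ≡ true → ground M a ∧ ground N b ≡ true → Y (a , b) ≡ true) →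
             rk P X ≤ rk P Y
  rkP-mono h = P.rk-mono′ (λ { (a , b) Xab Pab → h a b Xab (trans (sym (ground-prod (a , b))) Pab) })

  rkP-cong : ∀ {X Y} → (∀ a b → ground M a ∧ ground N b ≡ true → X (a , b) ≡ Y (a , b)) → rk P X ≡ rk P Y
  rkP-cong {X} {Y} h =
    IsMatroid.rk-cong P-matroid X Y (λ { (a , b) Pab → h a b (trans (sym (ground-prod (a , b))) Pab) })

  rk-row≤ρ : ∀ a → rk P (singleton a ×ˢ ground N) ≤ ρ
  rk-row≤ρ a with ground M a in Ma | rk M (singleton a) ≟ℕ 0
  ... | true  | no a-nonloop = ≤-reflexive (sym (row-iso a (Ma , a-nonloop) (ground N) (λ _ h → h)))
  ... | true  | yes a-loop   = ≤-trans (≤-reflexive (row-loop a (Ma , a-loop))) z≤n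
  ... | false | _            = ≤-trans (rkP-mono outside) (≤-trans (≤-reflexive P.rk-∅) z≤n)
    where
    outside : ∀ x b → singleton a x ∧ ground N b ≡ true → ground M x ∧ ground N b ≡ true → false ≡ true
    outside x b h g = trans (sym Ma) (singleton-∈ {Z = ground M} (∧-conicalˡ _ _ h) (∧-conicalˡ _ _ g))

  rk-add-spanned-point : ∀ {Y a y A} → ground N y ≡ true → rk M (Y ∪ singleton a) ≡ rk M Y →
                         (Y ×ˢ ground N) ⊆ A → rk P (A ∪ (singleton a ×ˢ singleton y)) ≤ rk P A
  rk-add-spanned-point {Y} {a} {y} {A} Ny spanned Y×N⊆A with rk N (singleton y) ≟ℕ 0
  ... | yes y-loop = P.rk-∪-≤ˡ A (singleton a ×ˢ singleton y) (begin
    rk P (singleton a ×ˢ singleton y)  ≤⟨ rkP-mono point⊆column ⟩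
    rk P (ground M ×ˢ singleton y)     ≡⟨ col-loop y (Ny , y-loop) ⟩
    0                                  ≤⟨ z≤n ⟩
    _                                  ∎)
    where
    open ≤-Reasoning
    in-column : ∀ s t e n → s ∧ t ≡ true → e ∧ n ≡ true → e ∧ t ≡ true
    in-column = byTruthTable

    point⊆column : ∀ x b → (singleton a ×ˢ singleton y) (x , b) ≡ true → ground M x ∧ ground N b ≡ true →
                   (ground M ×ˢ singleton y) (x , b) ≡ true
    point⊆column x b = in-column (singleton a x) (singleton y b) (ground M x) (ground N b)
  ... | no y-nonloop = begin
    rk P (A ∪ (singleton a ×ˢ singleton y))  ≤⟨ rkP-mono A∪point⊆A∪C ⟩
    rk P (A ∪ C)                             ≤⟨ P.rk-∪-≤ˡ A C (≤-trans (≤-reflexive rkC≡rkD) (rkP-mono D⊆A∩C)) ⟩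
    rk P A                                   ∎
    where
    open ≤-Reasoning
    C D : SubsetOf (Fin m × Fin n)
    C = ((Y ∪ singleton a) ∩ ground M) ×ˢ singleton y
    D = (Y ∩ ground M) ×ˢ singleton y

    column : ∀ {Z} → Z ⊆ ground M → rk M Z ≡ rk P (Z ×ˢ singleton y)
    column = col-iso y (Ny , y-nonloop) _

    rkC≡rkD : rk P C ≡ rk P D
    rkC≡rkD = begin-equality
      rk P C                               ≡⟨ sym (column (λ _ → ∧-conicalʳ _ _)) ⟩
      rk M ((Y ∪ singleton a) ∩ ground M)  ≡⟨ M.rk-∩-ground _ ⟩
      rk M (Y ∪ singleton a)               ≡⟨ spanned ⟩
      rk M Y                               ≡⟨ sym (M.rk-∩-ground Y) ⟩
      rk M (Y ∩ ground M)                  ≡⟨ column (λ _ → ∧-conicalʳ _ _) ⟩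
      rk P D                               ∎

    join : ∀ α y′ s e t n → α ∨ (s ∧ t) ≡ true → e ∧ n ≡ true → α ∨ (((y′ ∨ s) ∧ e) ∧ t) ≡ true
    join = byTruthTable

    A∪point⊆A∪C : ∀ x b → (A ∪ (singleton a ×ˢ singleton y)) (x , b) ≡ true → ground M x ∧ ground N b ≡ true →
                  (A ∪ C) (x , b) ≡ true
    A∪point⊆A∪C x b = join (A (x , b)) (Y x) (singleton a x) (ground M x) (singleton y b) (ground N b)

    meet : ∀ α y′ s e t n → (y′ ∧ n ≡ true → α ≡ true) → (y′ ∧ e) ∧ t ≡ true → e ∧ n ≡ true →
           α ∧ (((y′ ∨ s) ∧ e) ∧ t) ≡ true
    meet = byTruthTable

    D⊆A∩C : ∀ x b → D (x , b) ≡ true → ground M x ∧ ground N b ≡ true → (A ∩ C) (x , b) ≡ true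
    D⊆A∩C x b = meet (A (x , b)) (Y x) (singleton a x) (ground M x) (singleton y b) (ground N b) (Y×N⊆A (x , b))

  rk-add-spanned-row : ∀ {Y a A} → rk M (Y ∪ singleton a) ≡ rk M Y → (Y ×ˢ ground N) ⊆ A →
                       rk P (A ∪ (singleton a ×ˢ ground N)) ≤ rk P A
  rk-add-spanned-row {Y} {a} {A} spanned Y×N⊆A =
    subset-induction (λ X → rk P (A ∪ (singleton a ×ˢ X)) ≤ rk P A) resp base (ground N) step
    where
    resp : ∀ {X X′} → X ≐ X′ → rk P (A ∪ (singleton a ×ˢ X)) ≤ rk P A →
           rk P (A ∪ (singleton a ×ˢ X′)) ≤ rk P A
    resp X≐X′ = subst (_≤ rk P A)
      (P.rk-resp-≐ (λ { (x , b) → cong (λ z → A (x , b) ∨ (singleton a x ∧ z)) (X≐X′ b) }))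

    base : rk P (A ∪ (singleton a ×ˢ ∅)) ≤ rk P A
    base = ≤-reflexive (P.rk-resp-≐ (λ p → trans (cong (A p ∨_) (∧-zeroʳ _)) (∨-identityʳ _)))

    step : ∀ X y → ground N y ≡ true → rk P (A ∪ (singleton a ×ˢ X)) ≤ rk P A →
           rk P (A ∪ (singleton a ×ˢ (X ∪ singleton y))) ≤ rk P A
    step X y Ny ih = begin
      rk P (A ∪ (singleton a ×ˢ (X ∪ singleton y)))                    ≡⟨ P.rk-resp-≐ split ⟩
      rk P ((A ∪ (singleton a ×ˢ X)) ∪ (singleton a ×ˢ singleton y))  ≤⟨ rk-add-spanned-point Ny spanned
                                                                            (λ p h → ∨-trueˡ (Y×N⊆A p h)) ⟩
      rk P (A ∪ (singleton a ×ˢ X))                                    ≤⟨ ih ⟩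
      rk P A                                                           ∎
      where
      open ≤-Reasoning
      regroup : ∀ α s x t → α ∨ (s ∧ (x ∨ t)) ≡ (α ∨ (s ∧ x)) ∨ (s ∧ t)
      regroup = byTruthTable

      split : A ∪ (singleton a ×ˢ (X ∪ singleton y)) ≐ (A ∪ (singleton a ×ˢ X)) ∪ (singleton a ×ˢ singleton y)
      split (x , b) = regroup (A (x , b)) (singleton a x) (X b) (singleton y b)

  cylRank : SubsetOf (Fin m × Fin n) → SubsetOf (Fin m) → ℕ
  cylRank Q Y = rk P ((Y ×ˢ ground N) ∪ Q)

  cylRank-resp-≐ : ∀ Q → Respects≐ (cylRank Q)
  cylRank-resp-≐ Q Y≐Y′ = P.rk-resp-≐ (λ { (x , b) → cong (λ z → (z ∧ ground N b) ∨ Q (x , b)) (Y≐Y′ x) })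

  cylRank-∪-row : ∀ Q Y a →
                  cylRank Q (Y ∪ singleton a) ≡ rk P (((Y ×ˢ ground N) ∪ Q) ∪ (singleton a ×ˢ ground N))
  cylRank-∪-row Q Y a = P.rk-resp-≐ (λ { (x , b) → regroup (Y x) (singleton a x) (ground N b) (Q (x , b)) })
    where
    regroup : ∀ y s n q → ((y ∨ s) ∧ n) ∨ q ≡ ((y ∧ n) ∨ q) ∨ (s ∧ n)
    regroup = byTruthTable

  cylRank-step : ∀ Q Y a →
                 cylRank Q (Y ∪ singleton a) + rk P (((Y ×ˢ ground N) ∪ Q) ∩ (singleton a ×ˢ ground N))
                   ≤ cylRank Q Y + ρ
  cylRank-step Q Y a = begin
    cylRank Q (Y ∪ singleton a) + rk P (A ∩ B) ≡⟨ cong (_+ rk P (A ∩ B)) (cylRank-∪-row Q Y a) ⟩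
    rk P (A ∪ B) + rk P (A ∩ B)               ≤⟨ IsMatroid.rk-submod P-matroid A B ⟩
    rk P A + rk P B                           ≤⟨ +-monoʳ-≤ (rk P A) (rk-row≤ρ a) ⟩
    rk P A + ρ                                ∎
    where
    open ≤-Reasoning
    A = (Y ×ˢ ground N) ∪ Q
    B = singleton a ×ˢ ground N

  cylRank-growth : ∀ Q d W Y₀ →
                   (∀ Y a → W a ≡ true → rk M (Y ∪ singleton a) ≢ rk M Y →
                      cylRank Q (Y ∪ singleton a) ≤ cylRank Q Y + d) →
                   cylRank Q (Y₀ ∪ W) + d * rk M Y₀ ≤ cylRank Q Y₀ + d * rk M (Y₀ ∪ W)
  cylRank-growth Q d W Y₀ grows =
    telescope (cylRank Q) (λ Y → d * rk M Y) (cylRank-resp-≐ Q) (cong (d *_) ∘ M.rk-resp-≐) W local Y₀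
    where
    local : ∀ Y a → W a ≡ true →
            cylRank Q (Y ∪ singleton a) + d * rk M Y ≤ cylRank Q Y + d * rk M (Y ∪ singleton a)
    local Y a Wa = increment-bound d (M.rk-mono′ (λ _ h _ → ∨-trueˡ h))
      (λ spanned → ≤-trans (≤-reflexive (cylRank-∪-row Q Y a)) (rk-add-spanned-row spanned (λ _ h → ∨-trueˡ h)))
      (grows Y a Wa)

  rk-cylinder : ∀ Y → rk P (Y ×ˢ ground N) ≡ ρ * rk M Y
  rk-cylinder Y = ≤-antisym upper lower
    where
    growth : ∀ W Y₀ → cylRank ∅ (Y₀ ∪ W) + ρ * rk M Y₀ ≤ cylRank ∅ Y₀ + ρ * rk M (Y₀ ∪ W)
    growth W Y₀ = cylRank-growth ∅ ρ W Y₀ (λ Y′ a _ _ → m+n≤o⇒m≤o _ (cylRank-step ∅ Y′ a))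

    cylRank-∅ : ∀ Z → cylRank ∅ Z ≡ rk P (Z ×ˢ ground N)
    cylRank-∅ Z = P.rk-resp-≐ (λ p → ∨-identityʳ _)

    upper : rk P (Y ×ˢ ground N) ≤ ρ * rk M Y
    upper = subst₂ _≤_ (cylRank-∅ Y) (cong (_+ ρ * rk M Y) P.rk-∅) (m+n≤o⇒m≤o _ (growth Y ∅))

    rank-M : rk M (Y ∪ (λ _ → true)) ≡ rank M
    rank-M = M.rk-resp-≐ (λ a → ∨-zeroʳ (Y a))

    full : cylRank ∅ (Y ∪ (λ _ → true)) ≡ ρ * rank M
    full = begin
      cylRank ∅ (Y ∪ (λ _ → true)) ≡⟨ rkP-cong (λ a b g → everything (Y a) (ground M a) (ground N b) g) ⟩
      rank P                       ≡⟨ rank-eq ⟩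
      rank M * rank N              ≡⟨ cong (rank M *_) rank-N≡ρ ⟩
      rank M * ρ                   ≡⟨ *-comm (rank M) ρ ⟩
      ρ * rank M                   ∎
      where
      open ≡-Reasoning
      everything : ∀ y e n → e ∧ n ≡ true → ((y ∨ true) ∧ n) ∨ false ≡ true
      everything = byTruthTable

    lower : ρ * rk M Y ≤ rk P (Y ×ˢ ground N)
    lower = +-cancelˡ-≤ (ρ * rank M) _ _
      (subst₂ _≤_ (cong (_+ ρ * rk M Y) full)
                  (trans (cong₂ _+_ (cylRank-∅ Y) (cong (ρ *_) rank-M)) (+-comm _ (ρ * rank M)))
                  (growth (λ _ → true) Y))

  module Minor {S T : SubsetOf (Fin m)} (T⊆E : T ⊆ ground M) (S∩T≡∅ : Disjoint S T) where
    M′ : RankFn (Fin m)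
    M′ = M ∖∖ S // T

    K : SubsetOf (Fin m × Fin n)
    K = T ×ˢ ground N

    P′ : RankFn (Fin m × Fin n)
    P′ = P ∖∖ (S ×ˢ ground N) // K

    E′⊆E : ground M′ ⊆ ground M
    E′⊆E _ h = ∧-conicalˡ _ _ (∧-conicalˡ _ _ h)

    rk-M′ : ∀ {X} → X ⊆ ground M′ → rk M′ X ≡ rk M (X ∪ T) ∸ rk M T
    rk-M′ = rk-minor M-matroid S T

    ground-P′ : ∀ p → ground P′ p ≡ (ground M′ ×ˢ ground N) p
    ground-P′ (a , b) rewrite ground-prod (a , b) = regroup (ground M a) (ground N b) (S a) (T a)
      where
      regroup : ∀ e n s t → ((e ∧ n) ∧ not (s ∧ n)) ∧ not (t ∧ n) ≡ ((e ∧ not s) ∧ not t) ∧ n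
      regroup = byTruthTable

    rk-P′ : ∀ {Z} → Z ⊆ (ground M′ ×ˢ ground N) → rk P′ Z ≡ rk P (Z ∪ K) ∸ ρ * rk M T
    rk-P′ Z⊆ = trans (rk-minor P-matroid _ K (λ p h → trans (ground-P′ p) (Z⊆ p h)))
                     (cong (rk P (_ ∪ K) ∸_) (rk-cylinder T))

    rk-row∪K : ∀ e → rk P ((singleton e ×ˢ ground N) ∪ K) ≡ ρ * rk M (singleton e ∪ T)
    rk-row∪K e = trans (P.rk-resp-≐ (λ p → sym (×ˢ-distribʳ-∪ (singleton e) T (ground N) p)))
                       (rk-cylinder (singleton e ∪ T))

    P′-row-iso : ∀ e → IsNonLoop M′ e → ∀ X → X ⊆ ground N → rk N X ≡ rk P′ (singleton e ×ˢ X)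
    P′-row-iso e (e∈E′ , e-nonloop) X X⊆N = begin-equality
      rk N X                            ≡⟨ sym (m+n∸m≡n (ρ * rk M T) (rk N X)) ⟩
      ρ * rk M T + rk N X ∸ ρ * rk M T  ≡⟨ cong (_∸ ρ * rk M T) (sym (≤-antisym upper lower)) ⟩
      rk P (eX ∪ K) ∸ ρ * rk M T        ≡⟨ sym (rk-P′ (×ˢ-⊆ (singleton-⊆ e∈E′) X⊆N)) ⟩
      rk P′ eX                          ∎
      where
      open ≤-Reasoning
      eX eN : SubsetOf (Fin m × Fin n)
      eX = singleton e ×ˢ X
      eN = singleton e ×ˢ ground N

      T<T∪e : suc (rk M T) ≤ rk M (singleton e ∪ T)
      T<T∪e = ≰⇒> (λ T∪e≤T → e-nonloop (trans (rk-M′ (singleton-⊆ e∈E′)) (m≤n⇒m∸n≡0 T∪e≤T)))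

      e-nonloopᴹ : rk M (singleton e) ≢ 0
      e-nonloopᴹ e-loop = <⇒≱ T<T∪e (≤-reflexive (begin-equality
        rk M (singleton e ∪ T)  ≡⟨ M.rk-resp-≐ (λ x → ∨-comm (singleton e x) (T x)) ⟩
        rk M (T ∪ singleton e)  ≡⟨ M.rk-∪-null T e-loop ⟩
        rk M T                  ∎))

      row : rk N X ≡ rk P eX
      row = row-iso e (E′⊆E e e∈E′ , e-nonloopᴹ) X X⊆N

      upper : rk P (eX ∪ K) ≤ ρ * rk M T + rk N X
      upper = ≤-trans (P.rk-subadditive eX K)
                      (≤-reflexive (trans (+-comm (rk P eX) (rk P K)) (cong₂ _+_ (rk-cylinder T) (sym row))))

      union : ∀ s x t n → (x ≡ true → n ≡ true) → ((s ∧ x) ∨ (t ∧ n)) ∨ (s ∧ n) ≡ (s ∧ n) ∨ (t ∧ n)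
      union = byTruthTable

      meet : ∀ s x t n → (x ≡ true → n ≡ true) → s ∧ x ≡ true → ((s ∧ x) ∨ (t ∧ n)) ∧ (s ∧ n) ≡ true
      meet = byTruthTable

      rk-union : rk P ((eX ∪ K) ∪ eN) ≡ ρ * rk M (singleton e ∪ T)
      rk-union = trans (P.rk-resp-≐ (λ { (x , b) → union (singleton e x) (X b) (T x) (ground N b) (X⊆N b) }))
                       (rk-row∪K e)

      rk-meet : rk N X ≤ rk P ((eX ∪ K) ∩ eN)
      rk-meet = ≤-trans (≤-reflexive row)
        (P.rk-mono′ (λ { (x , b) h _ → meet (singleton e x) (X b) (T x) (ground N b) (X⊆N b) h }))

      lower : ρ * rk M T + rk N X ≤ rk P (eX ∪ K)
      lower = +-cancelˡ-≤ ρ _ _ (begin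
        ρ + (ρ * rk M T + rk N X)                    ≡⟨ sym (+-assoc ρ _ _) ⟩
        ρ + ρ * rk M T + rk N X                      ≡⟨ cong (_+ rk N X) (sym (*-suc ρ (rk M T))) ⟩
        ρ * suc (rk M T) + rk N X                    ≤⟨ +-mono-≤ (*-monoʳ-≤ ρ T<T∪e) rk-meet ⟩
        ρ * rk M (singleton e ∪ T) + rk P ((eX ∪ K) ∩ eN)
                                                     ≡⟨ cong (_+ rk P ((eX ∪ K) ∩ eN)) (sym rk-union) ⟩
        rk P ((eX ∪ K) ∪ eN) + rk P ((eX ∪ K) ∩ eN)  ≤⟨ IsMatroid.rk-submod P-matroid _ _ ⟩
        rk P (eX ∪ K) + rk P eN                      ≤⟨ +-monoʳ-≤ _ (rk-row≤ρ e) ⟩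
        rk P (eX ∪ K) + ρ                            ≡⟨ +-comm _ ρ ⟩
        ρ + rk P (eX ∪ K)                            ∎)

    P′-row-loop : ∀ e → IsLoop M′ e → rk P′ (singleton e ×ˢ ground N) ≡ 0
    P′-row-loop e (e∈E′ , e-loop) = trans (rk-P′ (×ˢ-⊆ˡ (ground N) (singleton-⊆ e∈E′))) (m≤n⇒m∸n≡0 (begin
      rk P ((singleton e ×ˢ ground N) ∪ K)  ≡⟨ rk-row∪K e ⟩
      ρ * rk M (singleton e ∪ T)            ≤⟨ *-monoʳ-≤ ρ T∪e≤T ⟩
      ρ * rk M T                            ∎))
      where
      open ≤-Reasoning
      T∪e≤T : rk M (singleton e ∪ T) ≤ rk M T
      T∪e≤T = m∸n≡0⇒m≤n (trans (sym (rk-M′ (singleton-⊆ e∈E′))) e-loop)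

    P′-col-loop : ∀ f → IsLoop N f → rk P′ (ground M′ ×ˢ singleton f) ≡ 0
    P′-col-loop f (f∈N , f-loop) = trans (rk-P′ (×ˢ-⊆ʳ (ground M′) (singleton-⊆ f∈N))) (m≤n⇒m∸n≡0 (begin
      rk P ((ground M′ ×ˢ singleton f) ∪ K)     ≤⟨ P.rk-subadditive _ K ⟩
      rk P (ground M′ ×ˢ singleton f) + rk P K  ≤⟨ +-monoˡ-≤ (rk P K) (P.rk-mono′ (λ p h _ → E′f⊆Ef p h)) ⟩
      rk P (ground M ×ˢ singleton f) + rk P K   ≡⟨ cong₂ _+_ (col-loop f (f∈N , f-loop)) (rk-cylinder T) ⟩
      ρ * rk M T                                ∎))
      where
      open ≤-Reasoning
      E′f⊆Ef : (ground M′ ×ˢ singleton f) ⊆ (ground M ×ˢ singleton f)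
      E′f⊆Ef = ×ˢ-⊆ˡ (singleton f) E′⊆E

    P′-rank : rank P′ ≡ rank M′ * rank N
    P′-rank = begin
      rank P′                                     ≡⟨ rank-minor P-matroid (S ×ˢ ground N) K K⊆P S×N∩K≡∅ ⟩
      rk P (ground P ∖ (S ×ˢ ground N)) ∸ rk P K  ≡⟨ cong₂ _∸_ (trans (P.rk-resp-≐ delete-S) (rk-cylinder _))
                                                              (rk-cylinder T) ⟩
      ρ * rk M (ground M ∖ S) ∸ ρ * rk M T        ≡⟨ sym (*-distribˡ-∸ ρ _ _) ⟩
      ρ * (rk M (ground M ∖ S) ∸ rk M T)          ≡⟨ cong (ρ *_) (sym (rank-minor M-matroid S T T⊆E S∩T≡∅)) ⟩
      ρ * rank M′                                 ≡⟨ *-comm ρ _ ⟩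
      rank M′ * ρ                                 ≡⟨ cong (rank M′ *_) (sym rank-N≡ρ) ⟩
      rank M′ * rank N                            ∎
      where
      open ≡-Reasoning
      K⊆P : K ⊆ ground P
      K⊆P p h = trans (ground-prod p) (×ˢ-⊆ˡ (ground N) T⊆E p h)

      disjoint : ∀ s t n → (s ≡ true → t ≡ false) → s ∧ n ≡ true → t ∧ n ≡ false
      disjoint = byTruthTable

      S×N∩K≡∅ : Disjoint (S ×ˢ ground N) K
      S×N∩K≡∅ (a , b) = disjoint (S a) (T a) (ground N b) (S∩T≡∅ a)

      remove : ∀ e n s → (e ∧ n) ∧ not (s ∧ n) ≡ (e ∧ not s) ∧ n
      remove = byTruthTable

      delete-S : ground P ∖ (S ×ˢ ground N) ≐ (ground M ∖ S) ×ˢ ground N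
      delete-S (a , b) rewrite ground-prod (a , b) = remove (ground M a) (ground N b) (S a)

    module ColumnIso {f} (f∈N : ground N f ≡ true) (f-nonloop : rk N (singleton f) ≢ 0)
                     {X} (X⊆E′ : X ⊆ ground M′) where
      private
        Xf XTf : SubsetOf (Fin m × Fin n)
        Xf  = X ×ˢ singleton f
        XTf = (X ∪ T) ×ˢ singleton f

        f∈N′ : singleton f ⊆ ground N
        f∈N′ = singleton-⊆ f∈N

        X⊆E : X ⊆ ground M
        X⊆E a h = E′⊆E a (X⊆E′ a h)

        X∪T⊆E : (X ∪ T) ⊆ ground M
        X∪T⊆E a h with X a in Xa
        ... | true  = X⊆E a Xa
        ... | false = T⊆E a h

        column : ∀ {Z} → Z ⊆ ground M → rk M Z ≡ rk P (Z ×ˢ singleton f)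
        column = col-iso f (f∈N , f-nonloop) _

        d : ℕ
        d = ρ ∸ 1

        ρ≡1+d : ρ ≡ suc d
        ρ≡1+d = sym (m+[n∸m]≡n (≤-trans (n≢0⇒n>0 f-nonloop) (N.rk-mono′ (λ b h _ → f∈N′ b h))))

        ρ*-expand : ∀ r → ρ * r ≡ r + d * r
        ρ*-expand r = cong (_* r) ρ≡1+d

        F : ℕ
        F = rk P (Xf ∪ K)

        union : ∀ x t φ n → (φ ≡ true → n ≡ true) → (x ∧ φ) ∨ (t ∧ n) ≡ ((x ∨ t) ∧ φ) ∨ (t ∧ n)
        union = byTruthTable

        meet : ∀ x t φ n → (φ ≡ true → n ≡ true) → t ∧ φ ≡ ((x ∨ t) ∧ φ) ∧ (t ∧ n)
        meet = byTruthTable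

        F≡rk-XTf∪K : F ≡ rk P (XTf ∪ K)
        F≡rk-XTf∪K = P.rk-resp-≐ (λ { (x , b) → union (X x) (T x) (singleton f b) (ground N b) (f∈N′ b) })

        rk-XTf∩K : rk M T ≡ rk P (XTf ∩ K)
        rk-XTf∩K = trans (column T⊆E)
          (P.rk-resp-≐ (λ { (x , b) → meet (X x) (T x) (singleton f b) (ground N b) (f∈N′ b) }))

        F-upper : F ≤ rk M (X ∪ T) + d * rk M T
        F-upper = +-cancelʳ-≤ (rk M T) _ _ (begin
          F + rk M T                            ≡⟨ cong₂ _+_ F≡rk-XTf∪K rk-XTf∩K ⟩
          rk P (XTf ∪ K) + rk P (XTf ∩ K)       ≤⟨ IsMatroid.rk-submod P-matroid XTf K ⟩
          rk P XTf + rk P K                     ≡⟨ cong₂ _+_ (sym (column X∪T⊆E)) (trans (rk-cylinder T) (ρ*-expand _)) ⟩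
          rk M (X ∪ T) + (rk M T + d * rk M T)  ≡⟨ solve 3 (λ x t dt → x :+ (t :+ dt) := (x :+ dt) :+ t) refl
                                                           (rk M (X ∪ T)) (rk M T) (d * rk M T) ⟩
          rk M (X ∪ T) + d * rk M T + rk M T    ∎)
          where open ≤-Reasoning

        -- Adding a point a ∈ X that raises rk M costs at most ρ − 1, because (a , f) ∈ Xf already
        -- contributes rk M {a} ≥ 1 to the row of a.
        cost : ∀ Y a → X a ≡ true → rk M (Y ∪ singleton a) ≢ rk M Y →
               cylRank Xf (Y ∪ singleton a) ≤ cylRank Xf Y + d
        cost Y a Xa grows = ≤-pred (begin
          suc (cylRank Xf (Y ∪ singleton a))            ≡⟨ +-comm 1 _ ⟩
          cylRank Xf (Y ∪ singleton a) + 1              ≤⟨ +-monoʳ-≤ _ one≤ ⟩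
          cylRank Xf (Y ∪ singleton a) + rk P (AY ∩ B)  ≤⟨ cylRank-step Xf Y a ⟩
          cylRank Xf Y + ρ                              ≡⟨ trans (cong (cylRank Xf Y +_) ρ≡1+d) (+-suc _ d) ⟩
          suc (cylRank Xf Y + d)                        ∎)
          where
          open ≤-Reasoning
          AY B : SubsetOf (Fin m × Fin n)
          AY = (Y ×ˢ ground N) ∪ Xf
          B  = singleton a ×ˢ ground N

          a-nonloop : rk M (singleton a) ≢ 0
          a-nonloop a-loop = grows (M.rk-∪-null Y a-loop)

          pointwise : ∀ s φ y n x → (s ≡ true → x ≡ true) → (φ ≡ true → n ≡ true) → s ∧ φ ≡ true →
                      ((y ∧ n) ∨ (x ∧ φ)) ∧ (s ∧ n) ≡ true
          pointwise = byTruthTable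

          af⊆AY∩B : (singleton a ×ˢ singleton f) ⊆ (AY ∩ B)
          af⊆AY∩B (x , b) = pointwise (singleton a x) (singleton f b) (Y x) (ground N b) (X x)
                                      (singleton-⊆ Xa x) (f∈N′ b)

          one≤ : 1 ≤ rk P (AY ∩ B)
          one≤ = begin
            1                                  ≤⟨ n≢0⇒n>0 a-nonloop ⟩
            rk M (singleton a)                 ≡⟨ column (singleton-⊆ (X⊆E a Xa)) ⟩
            rk P (singleton a ×ˢ singleton f)  ≤⟨ P.rk-mono′ (λ p h _ → af⊆AY∩B p h) ⟩
            rk P (AY ∩ B)                      ∎

        T∪X≡X∪T : rk M (T ∪ X) ≡ rk M (X ∪ T)
        T∪X≡X∪T = M.rk-resp-≐ (λ a → ∨-comm (T a) (X a))

        absorb : ∀ t x φ n → (φ ≡ true → n ≡ true) → ((t ∨ x) ∧ n) ∨ (x ∧ φ) ≡ (t ∨ x) ∧ n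
        absorb = byTruthTable

        cylRank-T∪X : cylRank Xf (T ∪ X) ≡ rk M (X ∪ T) + d * rk M (X ∪ T)
        cylRank-T∪X = begin
          cylRank Xf (T ∪ X)                 ≡⟨ P.rk-resp-≐ (λ { (x , b) →
                                                  absorb (T x) (X x) (singleton f b) (ground N b) (f∈N′ b) }) ⟩
          rk P ((T ∪ X) ×ˢ ground N)         ≡⟨ rk-cylinder (T ∪ X) ⟩
          ρ * rk M (T ∪ X)                   ≡⟨ trans (cong (ρ *_) T∪X≡X∪T) (ρ*-expand _) ⟩
          rk M (X ∪ T) + d * rk M (X ∪ T)    ∎
          where open ≡-Reasoning

        F-lower : rk M (X ∪ T) + d * rk M T ≤ F
        F-lower = +-cancelʳ-≤ (d * rk M (X ∪ T)) _ _ (begin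
          rk M (X ∪ T) + d * rk M T + d * rk M (X ∪ T)  ≡⟨ solve 3 (λ x t dx → (x :+ t) :+ dx := (x :+ dx) :+ t) refl
                                                                   (rk M (X ∪ T)) (d * rk M T) (d * rk M (X ∪ T)) ⟩
          rk M (X ∪ T) + d * rk M (X ∪ T) + d * rk M T  ≡⟨ cong (_+ d * rk M T) (sym cylRank-T∪X) ⟩
          cylRank Xf (T ∪ X) + d * rk M T               ≤⟨ cylRank-growth Xf d X T cost ⟩
          cylRank Xf T + d * rk M (T ∪ X)               ≡⟨ cong₂ _+_ (P.rk-resp-≐ (λ p → ∨-comm (K p) (Xf p)))
                                                                      (cong (d *_) T∪X≡X∪T) ⟩
          F + d * rk M (X ∪ T)                          ∎)
          where open ≤-Reasoning

      P′-col-iso : rk M′ X ≡ rk P′ Xf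
      P′-col-iso = begin
        rk M′ X                                            ≡⟨ rk-M′ X⊆E′ ⟩
        rk M (X ∪ T) ∸ rk M T                              ≡⟨ sym ([m+n]∸[m+o]≡n∸o (d * rk M T) _ (rk M T)) ⟩
        d * rk M T + rk M (X ∪ T) ∸ (d * rk M T + rk M T)  ≡⟨ cong₂ _∸_ F-exact ρ*T ⟩
        F ∸ ρ * rk M T                                     ≡⟨ sym (rk-P′ (×ˢ-⊆ X⊆E′ f∈N′)) ⟩
        rk P′ Xf                                           ∎
        where
        open ≡-Reasoning
        F-exact : d * rk M T + rk M (X ∪ T) ≡ F
        F-exact = trans (+-comm (d * rk M T) _) (≤-antisym F-lower F-upper)

        ρ*T : d * rk M T + rk M T ≡ ρ * rk M T
        ρ*T = trans (+-comm (d * rk M T) _) (sym (ρ*-expand _))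

    minor-isTensorProduct : IsTensorProduct M′ N P′
    minor-isTensorProduct = record
      { M-matroid = minor-isMatroid M-matroid S T
      ; N-matroid = N-matroid
      ; P-matroid = minor-isMatroid P-matroid (S ×ˢ ground N) K
      ; quasi     = record
        { ground-prod = ground-P′
        ; row-iso     = P′-row-iso
        ; col-iso     = λ f (f∈N , f-nonloop) X X⊆E′ → ColumnIso.P′-col-iso f∈N f-nonloop X⊆E′
        ; row-loop    = P′-row-loop
        ; col-loop    = P′-col-loop
        }
      ; rank-eq   = P′-rank
      }

mainTheorem7 : (m n : ℕ) (M : RankFn (Fin m)) (N : RankFn (Fin n))
    (P : RankFn (Fin m × Fin n)) (S T : SubsetOf (Fin m)) →
    S ⊆ ground M → T ⊆ ground M → Disjoint S T →
    IsTensorProduct M N P →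
    IsTensorProduct (M ∖∖ S // T) N
      (P ∖∖ (S ×ˢ ground N) // (T ×ˢ ground N))
mainTheorem7 m n M N P S T _ T⊆E S∩T≡∅ ten = TensorProduct.Minor.minor-isTensorProduct ten T⊆E S∩T≡∅
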